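{- Let $\mathcal B\subseteq 2^X$ be a nonempty bouquet of halved cubes with $d:=\mathrm{VC\text{ - }dim}_c(\mathcal B)$. Then: (i) for any element $e_i\in X$, $|\{\{e_i,e_j\}\in\mathcal B: e_j\in X\setminus\{e_i\}\}|\le d-1$; (ii) every $S\in\mathcal B$ satisfies $|S|\le d$; (iii) if $S\in\mathcal B$ is maximal by inclusion, then $\mathcal B\setminus\{S\}$ is still a bouquet of halved cubes.
   Context: $X$ is a finite set. A bouquet of halved cubes is an even set family $\mathcal B\subseteq 2^X$ (all sets of even cardinality) such that for every $S\in\mathcal B$, every subset of $S$ of even cardinality belongs to $\mathcal B$; a nonempty one contains $\varnothing$, i.e., is pointed. For $Y'\subseteq Y\subseteq X$ let $Q[Y',Y]=\{Z\subseteq X: Y'\subseteq Z\subseteq Y\}$; for $Z\in Q[Y',Y]$ its fiber is $F(Z)=\{Z\cup Z': Z'\subseteq X\setminus Y\}$, and $\pi_{Q[Y',Y]}(\mathcal S)=\{Z\in Q[Y',Y]: F(Z)\cap\mathcal S\neq\varnothing\}$. For $Y\subset X$ and $e\in X\setminus Y$, $P(e,Y)=\{\{e,y\}:y\in Y\}$ and $Q(e,Y)=Q[\{e\},Y\cup\{e\}]$. The pair $(e,Y)$ is c-shattered by $\mathcal S$ if there is a surjective map $f:\pi_{Q(e,Y)}(\mathcal S)\to P(e,Y)$ with $f(S)\subseteq S$ for all $S$ in its domain. For a pointed even family $\mathcal S$, $\mathrm{VC\text{ - }dim}_c(\mathcal S)=\max\{|Y|+1: Y\subset X,\ \exists e\in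 X\setminus Y \text{ with } (e,Y) \text{ c-shattered by } \mathcal S\}$. -}

module Defs where

open import Data.Nat using (ℕ; suc; _+_)
open import Data.Nat.Divisibility using (_∣_)
open import Data.Bool using (Bool; true; false; _∧_; not)
import Data.Bool.Properties as BoolP
open import Data.Fin using (Fin; _≟_)
open import Data.Fin.Subset using (Subset; _∈_; _∉_; _⊆_; _∪_; _∩_; ∁; ⁅_⁆; ∣_∣)
open import Data.Vec using (tabulate)
open import Data.Vec.Properties using (≡-dec)
open import Data.Product using (Σ; _×_; ∃; ∃-syntax)
open import Relation.Binary.PropositionalEquality using (_≡_)
open import Relation.Nullary using (does; ¬_)

-- The ground set X is Fin n. A set family 𝓢 ⊆ 2^X is given by its
-- (decidable) characteristic function Subset n → Bool.
Family : ℕ → Set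
Family n = Subset n → Bool

_∈F_ : ∀ {n} → Subset n → Family n → Set
S ∈F 𝓑 = 𝓑 S ≡ true

EvenCard : ∀ {n} → Subset n → Set
EvenCard S = 2 ∣ ∣ S ∣

IsEvenFamily : ∀ {n} → Family n → Set
IsEvenFamily 𝓑 = ∀ S → S ∈F 𝓑 → EvenCard S

IsBouquet : ∀ {n} → Family n → Set
IsBouquet 𝓑 = IsEvenFamily 𝓑 × (∀ S T → S ∈F 𝓑 → T ⊆ S → EvenCard T → T ∈F 𝓑)

Nonempty : ∀ {n} → Family n → Set
Nonempty 𝓑 = ∃[ S ] S ∈F 𝓑

InQ : ∀ {n} → Subset n → Subset n → Subset n → Set
InQ Y' Y Z = Y' ⊆ Z × Z ⊆ Y

-- Z ∈ π_{Q[Y',Y]}(𝓢): Z ∈ Q[Y',Y] and its fiber F(Z) = {Z ∪ Z' : Z' ⊆ X∖Y} meets 𝓢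
InProj : ∀ {n} → Subset n → Subset n → Family n → Subset n → Set
InProj Y' Y 𝓢 Z = InQ Y' Y Z × (∃[ Z' ] (Z' ⊆ ∁ Y × (Z ∪ Z') ∈F 𝓢))

InP : ∀ {n} → Fin n → Subset n → Subset n → Set
InP e Y T = ∃[ y ] (y ∈ Y × T ≡ ⁅ e ⁆ ∪ ⁅ y ⁆)

InProjQe : ∀ {n} → Fin n → Subset n → Family n → Subset n → Set
InProjQe e Y 𝓢 = InProj ⁅ e ⁆ (Y ∪ ⁅ e ⁆) 𝓢

CShattered : ∀ {n} → Family n → Fin n → Subset n → Set
CShattered 𝓢 e Y =
  e ∉ Y ×
  Σ ((Z : _) → InProjQe e Y 𝓢 Z → Subset _) λ f →
      (∀ Z (h : InProjQe e Y 𝓢 Z) → InP e Y (f Z h) × f Z h ⊆ Z)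
    × (∀ T → InP e Y T → ∃[ Z ] Σ (InProjQe e Y 𝓢 Z) λ h → f Z h ≡ T)

IsVCdimc : ∀ {n} → Family n → ℕ → Set
IsVCdimc 𝓢 d =
    (∃[ e ] ∃[ Y ] (CShattered 𝓢 e Y × d ≡ ∣ Y ∣ + 1))
  × (∀ e Y → CShattered 𝓢 e Y → ∣ Y ∣ + 1 Data.Nat.≤ d)

PairNeighbours : ∀ {n} → Family n → Fin n → Subset n
PairNeighbours 𝓑 i = tabulate λ j → not (does (j ≟ i)) ∧ 𝓑 (⁅ i ⁆ ∪ ⁅ j ⁆)

IsMaximal : ∀ {n} → Family n → Subset n → Set
IsMaximal 𝓑 S = S ∈F 𝓑 × (∀ T → T ∈F 𝓑 → S ⊆ T → T ≡ S)

removeF : ∀ {n} → Family n → Subset n → Family n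
removeF 𝓑 S T = 𝓑 T ∧ not (does (≡-dec BoolP._≟_ T S))

module Submission where

-- Fix a bouquet 𝓑 and a point i, and let N(i) be the set of
-- j ≠ i with {i,j} ∈ 𝓑.  The heart of the argument is that (i, N(i)) is
-- c-shattered by 𝓑: every member W of 𝓑 containing i has even size, so it
-- contains some other point z, and {i,z} ⊆ W is an even subset, hence in 𝓑,
-- i.e. z ∈ N(i).  Thus every Z in the projection π_{Q(i,N(i))}(𝓑) meets N(i)
-- (its fiber part avoids N(i)), and the map sending Z to {i,y} for such a
-- y ∈ Z ∩ N(i) is surjective onto P(i,N(i)), witnessed by the pairs
-- themselves.  Hence |N(i)| + 1 ≤ d, which is (i); and (ii) follows since a
-- member S containing e lies inside N(e) ∪ {e}.  Part (iii) is independent of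
-- the VC-dimension: removing a maximal member keeps the family even and
-- closed under even subsets.

open import Defs
open import Data.Nat using (ℕ; _≤_; _∸_; suc; _+_; z≤n; s≤s)
open import Data.Nat.Properties using (≤-trans; +-monoʳ-≤; n≤1+n; +-suc; m+n≤o⇒m≤o∸n)
open import Data.Nat.Divisibility using (_∣_; divides; >⇒∤)
open import Data.Bool using (Bool; true; false; _∧_; not)
import Data.Bool.Properties as BoolP
open import Data.Fin using (Fin; zero; suc; _≟_)
open import Data.Fin.Properties using (any?)
open import Data.Fin.Subset using (Subset; ∣_∣; _∈_; _∉_; _⊆_; _∪_; ⁅_⁆; ∁; ⊥)
open import Data.Fin.Subset.Properties
  using (x∈⁅x⁆; x∈⁅y⁆⇒x≡y; x∈p∪q⁻; x∈p∪q⁺; p⊆p∪q; q⊆p∪q; ∣⁅x⁆∣≡1; p⊆q⇒∣p∣≤∣q∣;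
         ∪-identityˡ; ∪-identityʳ; ∉⊥; ∣⊥∣≡0; x∈∁p⇒x∉p; _∈?_; ⊆-antisym; nonempty?; Empty-unique)
open import Data.Vec using ([]; _∷_; tabulate)
open import Data.Vec.Properties using (lookup∘tabulate; []=⇒lookup; lookup⇒[]=; ≡-dec)
open import Data.Product using (_×_; _,_; proj₁; proj₂; ∃)
open import Data.Sum using (inj₁; inj₂)
open import Data.Empty using (⊥-elim)
open import Function using (_∘_)
open import Relation.Nullary using (Dec; yes; no; does)
open import Relation.Nullary.Decidable using (_×-dec_; ¬?)
open import Relation.Binary.PropositionalEquality using (_≡_; refl; sym; trans; subst; cong; _≢_)

∣p∪q∣≤∣p∣+∣q∣ : ∀ {n} (p q : Subset n) → ∣ p ∪ q ∣ ≤ ∣ p ∣ + ∣ q ∣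
∣p∪q∣≤∣p∣+∣q∣ []          []          = z≤n
∣p∪q∣≤∣p∣+∣q∣ (true ∷ p)  (true ∷ q)  = s≤s (≤-trans (∣p∪q∣≤∣p∣+∣q∣ p q) (+-monoʳ-≤ ∣ p ∣ (n≤1+n ∣ q ∣)))
∣p∪q∣≤∣p∣+∣q∣ (true ∷ p)  (false ∷ q) = s≤s (∣p∪q∣≤∣p∣+∣q∣ p q)
∣p∪q∣≤∣p∣+∣q∣ (false ∷ p) (true ∷ q)  rewrite +-suc ∣ p ∣ ∣ q ∣ = s≤s (∣p∪q∣≤∣p∣+∣q∣ p q)
∣p∪q∣≤∣p∣+∣q∣ (false ∷ p) (false ∷ q) = ∣p∪q∣≤∣p∣+∣q∣ p q

∣⁅i⁆∪⁅j⁆∣≡2 : ∀ {n} (i j : Fin n) → i ≢ j → ∣ ⁅ i ⁆ ∪ ⁅ j ⁆ ∣ ≡ 2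
∣⁅i⁆∪⁅j⁆∣≡2 zero    zero    i≢j = ⊥-elim (i≢j refl)
∣⁅i⁆∪⁅j⁆∣≡2 zero    (suc j) _   rewrite ∪-identityˡ ⁅ j ⁆ = cong suc (∣⁅x⁆∣≡1 j)
∣⁅i⁆∪⁅j⁆∣≡2 (suc i) zero    _   rewrite ∪-identityʳ ⁅ i ⁆ = cong suc (∣⁅x⁆∣≡1 i)
∣⁅i⁆∪⁅j⁆∣≡2 (suc i) (suc j) i≢j = ∣⁅i⁆∪⁅j⁆∣≡2 i j (i≢j ∘ cong suc)

pair-even : ∀ {n} (i j : Fin n) → i ≢ j → EvenCard (⁅ i ⁆ ∪ ⁅ j ⁆)
pair-even i j i≢j rewrite ∣⁅i⁆∪⁅j⁆∣≡2 i j i≢j = divides 1 refl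

pair⊆ : ∀ {n} {i j : Fin n} {W : Subset n} → i ∈ W → j ∈ W → ⁅ i ⁆ ∪ ⁅ j ⁆ ⊆ W
pair⊆ {i = i} {j} i∈W j∈W {x} x∈pair with x∈p∪q⁻ ⁅ i ⁆ ⁅ j ⁆ x∈pair
... | inj₁ x∈⁅i⁆ = subst (_∈ _) (sym (x∈⁅y⁆⇒x≡y i x∈⁅i⁆)) i∈W
... | inj₂ x∈⁅j⁆ = subst (_∈ _) (sym (x∈⁅y⁆⇒x≡y j x∈⁅j⁆)) j∈W

-- An even set containing i contains a second point: otherwise it would be ⁅ i ⁆.
even-has-other : ∀ {n} {W : Subset n} {i : Fin n} → EvenCard W → i ∈ W → ∃ λ z → z ∈ W × z ≢ i
even-has-other {W = W} {i} even i∈W with any? (λ z → (z ∈? W) ×-dec ¬? (z ≟ i))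
... | yes other = other
... | no ¬other = ⊥-elim (>⇒∤ (s≤s (s≤s z≤n)) (subst (2 ∣_) ∣W∣≡1 even))
  where
  W⊆⁅i⁆ : W ⊆ ⁅ i ⁆
  W⊆⁅i⁆ {z} z∈W with z ≟ i
  ... | yes refl = x∈⁅x⁆ i
  ... | no z≢i   = ⊥-elim (¬other (z , z∈W , z≢i))

  ∣W∣≡1 : ∣ W ∣ ≡ 1
  ∣W∣≡1 = trans (cong ∣_∣ (⊆-antisym W⊆⁅i⁆ (λ z∈⁅i⁆ → subst (_∈ W) (sym (x∈⁅y⁆⇒x≡y i z∈⁅i⁆)) i∈W)))
                (∣⁅x⁆∣≡1 i)

∈-tabulate⁻ : ∀ {n} (f : Fin n → Bool) {j} → j ∈ tabulate f → f j ≡ true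
∈-tabulate⁻ f {j} j∈ = trans (sym (lookup∘tabulate f j)) ([]=⇒lookup j∈)

∈-tabulate⁺ : ∀ {n} (f : Fin n → Bool) {j} → f j ≡ true → j ∈ tabulate f
∈-tabulate⁺ f {j} fj = lookup⇒[]= j _ (trans (lookup∘tabulate f j) fj)

∈-neighbours⁻ : ∀ {n} (𝓑 : Family n) {i j} → j ∈ PairNeighbours 𝓑 i → j ≢ i × (⁅ i ⁆ ∪ ⁅ j ⁆) ∈F 𝓑
∈-neighbours⁻ 𝓑 {i} {j} j∈N = unfold (j ≟ i) (∈-tabulate⁻ _ j∈N)
  where
  unfold : (j≟i : Dec (j ≡ i)) → not (does j≟i) ∧ 𝓑 (⁅ i ⁆ ∪ ⁅ j ⁆) ≡ true →
           j ≢ i × (⁅ i ⁆ ∪ ⁅ j ⁆) ∈F 𝓑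
  unfold (yes _)   ()
  unfold (no j≢i) pair∈𝓑 = j≢i , pair∈𝓑

∈-neighbours⁺ : ∀ {n} (𝓑 : Family n) {i j} → j ≢ i → (⁅ i ⁆ ∪ ⁅ j ⁆) ∈F 𝓑 → j ∈ PairNeighbours 𝓑 i
∈-neighbours⁺ 𝓑 {i} {j} j≢i pair∈𝓑 = ∈-tabulate⁺ _ (fold (j ≟ i))
  where
  fold : (j≟i : Dec (j ≡ i)) → not (does j≟i) ∧ 𝓑 (⁅ i ⁆ ∪ ⁅ j ⁆) ≡ true
  fold (yes j≡i) = ⊥-elim (j≢i j≡i)
  fold (no _)    = pair∈𝓑

∈-removeF⁻ : ∀ {n} (𝓑 : Family n) {S T} → T ∈F removeF 𝓑 S → T ∈F 𝓑 × T ≢ S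
-- (the other cases make T∈ an absurd equation false ≡ true)
∈-removeF⁻ 𝓑 {S} {T} T∈ with 𝓑 T | ≡-dec BoolP._≟_ T S
... | true  | no T≢S = refl , T≢S

∈-removeF⁺ : ∀ {n} (𝓑 : Family n) {S T} → T ∈F 𝓑 → T ≢ S → T ∈F removeF 𝓑 S
∈-removeF⁺ 𝓑 {S} {T} T∈𝓑 T≢S rewrite T∈𝓑 with ≡-dec BoolP._≟_ T S
... | yes T≡S = ⊥-elim (T≢S T≡S)
... | no _    = refl

module Shattering {n : ℕ} (𝓑 : Family n) (bouquet : IsBouquet 𝓑) (i : Fin n) where

  N : Subset n
  N = PairNeighbours 𝓑 i

  i∉N : i ∉ N
  i∉N i∈N = proj₁ (∈-neighbours⁻ 𝓑 i∈N) refl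

  member⇒neighbour : ∀ {W z} → W ∈F 𝓑 → i ∈ W → z ∈ W → z ≢ i → z ∈ N
  member⇒neighbour {W} {z} W∈𝓑 i∈W z∈W z≢i =
    ∈-neighbours⁺ 𝓑 z≢i (proj₂ bouquet W _ W∈𝓑 (pair⊆ i∈W z∈W) (pair-even i z (z≢i ∘ sym)))

  -- Every Z in the projection onto Q(i,N) meets N: its fiber member W = Z ∪ Z'
  -- has another point besides i, which is a neighbour and so cannot lie in Z'.
  meets-N : ∀ {Z} → InProjQe i N 𝓑 Z → ∃ λ y → y ∈ Z × y ∈ N
  meets-N {Z} ((⁅i⁆⊆Z , _) , Z' , Z'⊆∁ , W∈𝓑) = in-Z (even-has-other (proj₁ bouquet _ W∈𝓑) i∈W)
    where
    i∈W : i ∈ Z ∪ Z'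
    i∈W = p⊆p∪q Z' (⁅i⁆⊆Z (x∈⁅x⁆ i))

    in-Z : (∃ λ z → z ∈ Z ∪ Z' × z ≢ i) → ∃ λ y → y ∈ Z × y ∈ N
    in-Z (z , z∈W , z≢i) with x∈p∪q⁻ Z Z' z∈W | member⇒neighbour W∈𝓑 i∈W z∈W z≢i
    ... | inj₁ z∈Z  | z∈N = z , z∈Z , z∈N
    ... | inj₂ z∈Z' | z∈N = ⊥-elim (x∈∁p⇒x∉p (Z'⊆∁ z∈Z') (p⊆p∪q ⁅ i ⁆ z∈N))

  f : (Z : Subset n) → InProjQe i N 𝓑 Z → Subset n
  f Z h = ⁅ i ⁆ ∪ ⁅ proj₁ (meets-N h) ⁆

  f-sound : ∀ Z (h : InProjQe i N 𝓑 Z) → InP i N (f Z h) × f Z h ⊆ Z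
  f-sound Z h@((⁅i⁆⊆Z , _) , _) with meets-N h
  ... | y , y∈Z , y∈N = (y , y∈N , refl) , pair⊆ (⁅i⁆⊆Z (x∈⁅x⁆ i)) y∈Z

  pair∈proj : ∀ {y} → y ∈ N → InProjQe i N 𝓑 (⁅ i ⁆ ∪ ⁅ y ⁆)
  pair∈proj {y} y∈N =
    (p⊆p∪q ⁅ y ⁆ , pair⊆ (q⊆p∪q N ⁅ i ⁆ (x∈⁅x⁆ i)) (p⊆p∪q ⁅ i ⁆ y∈N)) ,
    ⊥ , ⊥-elim ∘ ∉⊥ ,
    subst (_∈F 𝓑) (sym (∪-identityʳ _)) (proj₂ (∈-neighbours⁻ 𝓑 y∈N))

  -- On a pair {i,y} the chosen neighbour must be y itself, since i ∉ N.
  f-on-pair : ∀ {y} (y∈N : y ∈ N) → f (⁅ i ⁆ ∪ ⁅ y ⁆) (pair∈proj y∈N) ≡ ⁅ i ⁆ ∪ ⁅ y ⁆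
  f-on-pair {y} y∈N with meets-N (pair∈proj y∈N)
  ... | y' , y'∈pair , y'∈N with x∈p∪q⁻ ⁅ i ⁆ ⁅ y ⁆ y'∈pair
  ...   | inj₁ y'∈⁅i⁆ = ⊥-elim (i∉N (subst (_∈ N) (x∈⁅y⁆⇒x≡y i y'∈⁅i⁆) y'∈N))
  ...   | inj₂ y'∈⁅y⁆ = cong (λ z → ⁅ i ⁆ ∪ ⁅ z ⁆) (x∈⁅y⁆⇒x≡y y y'∈⁅y⁆)

  -- f is sound by f-sound and surjective since it fixes every pair {i,y}.
  shattered : CShattered 𝓑 i N
  shattered = i∉N , f , f-sound ,
    λ { _ (y , y∈N , refl) → _ , pair∈proj y∈N , f-on-pair y∈N }

neighbours-bound : ∀ {n} (𝓑 : Family n) (d : ℕ) → IsBouquet 𝓑 → IsVCdimc 𝓑 d →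
                   (i : Fin n) → ∣ PairNeighbours 𝓑 i ∣ + 1 ≤ d
neighbours-bound 𝓑 d bouquet (_ , maximal) i = maximal i _ (Shattering.shattered 𝓑 bouquet i)

-- Part (ii): a member containing e lies in N(e) ∪ {e}.
member-bound : ∀ {n} (𝓑 : Family n) (d : ℕ) → IsBouquet 𝓑 → IsVCdimc 𝓑 d →
               (S : Subset n) → S ∈F 𝓑 → ∣ S ∣ ≤ d
member-bound {n} 𝓑 d bouquet vc S S∈𝓑 with nonempty? S
... | no S-empty rewrite Empty-unique S-empty | ∣⊥∣≡0 n = z≤n
... | yes (e , e∈S) =
  ≤-trans (p⊆q⇒∣p∣≤∣q∣ S⊆N∪⁅e⁆)
    (≤-trans (∣p∪q∣≤∣p∣+∣q∣ N ⁅ e ⁆)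
      (subst (λ k → ∣ N ∣ + k ≤ d) (sym (∣⁅x⁆∣≡1 e)) (neighbours-bound 𝓑 d bouquet vc e)))
  where
  open Shattering 𝓑 bouquet e using (N; member⇒neighbour)
  S⊆N∪⁅e⁆ : S ⊆ N ∪ ⁅ e ⁆
  S⊆N∪⁅e⁆ {x} x∈S with x ≟ e
  ... | yes refl = q⊆p∪q N ⁅ e ⁆ (x∈⁅x⁆ e)
  ... | no x≢e   = p⊆p∪q ⁅ e ⁆ (member⇒neighbour S∈𝓑 e∈S x∈S x≢e)

-- Part (iii): removing a maximal member preserves evenness and downward closure,
-- since a proper even subset of a member cannot be the maximal member S.
remove-maximal : ∀ {n} (𝓑 : Family n) → IsBouquet 𝓑 → (S : Subset n) → IsMaximal 𝓑 S →
                 IsBouquet (removeF 𝓑 S)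
remove-maximal 𝓑 (even , closed) S (_ , maximal) = even′ , closed′
  where
  even′ : IsEvenFamily (removeF 𝓑 S)
  even′ T T∈ = even T (proj₁ (∈-removeF⁻ 𝓑 T∈))

  closed′ : ∀ T U → T ∈F removeF 𝓑 S → U ⊆ T → EvenCard U → U ∈F removeF 𝓑 S
  closed′ T U T∈ U⊆T evenU with ∈-removeF⁻ 𝓑 T∈
  ... | T∈𝓑 , T≢S = ∈-removeF⁺ 𝓑 (closed T U T∈𝓑 U⊆T evenU)
                      (λ U≡S → T≢S (maximal T T∈𝓑 (subst (_⊆ T) U≡S U⊆T)))

lemma8 : ∀ {n} (𝓑 : Family n) (d : ℕ) → IsBouquet 𝓑 → Nonempty 𝓑 → IsVCdimc 𝓑 d →
    ((i : Fin n) → ∣ PairNeighbours 𝓑 i ∣ ≤ d ∸ 1)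
    × ((S : Subset n) → S ∈F 𝓑 → ∣ S ∣ ≤ d)
    × ((S : Subset n) → IsMaximal 𝓑 S → IsBouquet (removeF 𝓑 S))
lemma8 𝓑 d bouquet _ vc =
  (λ i → m+n≤o⇒m≤o∸n _ (neighbours-bound 𝓑 d bouquet vc i)) ,
  member-bound 𝓑 d bouquet vc ,
  remove-maximal 𝓑 bouquet
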